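{- Let $M=p_1^{n_1}\cdots p_K^{n_K}$ and let $A,B\subset\mathbb{Z}_M$ with $A\oplus B=\mathbb{Z}_M$. Let $z,z'\in\mathbb{Z}_M$ and $a,a'\in A$, $b,b'\in B$ with $a+b=z$, $a'+b'=z'$. Then: (i) for every $m\mid M$ with $m\mid z-z'$, $(a-a',m)=(b-b',m)$; (ii) for every $i$ with $p_i^{n_i}\mid z-z'$, $a-a'$ and $b-b'$ match in the $p_i$ direction; (iii) if $a-a'$ and $b-b'$ do not match in the $p_j$ direction, and $\beta$ is the exponent with $p_j^\beta\parallel z-z'$, then $p_j^\beta\mid a-a'$ and $p_j^\beta\mid b-b'$.
   Context: $A\oplus B=\mathbb{Z}_M$ means every element of $\mathbb{Z}_M$ is uniquely $a+b$, $a\in A,b\in B$. For $x\in\mathbb{Z}_M$ and $m\mid M$, $(x,m)$ is the gcd of $m$ with a representative of $x$; divisibility $p^\beta\mid x$ for $p^\beta\mid M$ is well-defined, and $p_j^\beta\parallel x$ means $p_j^\beta\mid (x,M)$ but $p_j^{\beta+1}\nmid(x,M)$. Elements $u,v\in\mathbb{Z}_M$ match in the $p_i$ direction if $(u,p_i^{n_i})=(v,p_i^{n_i})$, and do not match otherwise. -}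

module Defs where

open import Data.Nat using (ℕ; zero; suc; _+_; _*_; _∸_; _^_; NonZero)
open import Data.Nat.DivMod using (_%_)
open import Data.Nat.Divisibility using (_∣_)
open import Data.Nat.GCD using (gcd)
open import Data.Fin using (Fin; toℕ)
import Data.Fin as F
open import Data.Product using (Σ; _×_; ∃-syntax)
open import Relation.Binary.PropositionalEquality using (_≡_)
open import Relation.Nullary using (¬_)

∏ : (K : ℕ) → (Fin K → ℕ) → ℕ
∏ zero    f = 1
∏ (suc K) f = f F.zero * ∏ K (λ i → f (F.suc i))

-- Z_M is modelled by Fin M (canonical representatives 0 … M-1).
-- "a + b = z in Z_M"
SumIs : (M : ℕ) .{{_ : NonZero M}} → Fin M → Fin M → Fin M → Set
SumIs M a b z = (toℕ a + toℕ b) % M ≡ toℕ z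

dif : (M : ℕ) .{{_ : NonZero M}} → Fin M → Fin M → ℕ
dif M x y = (toℕ x + (M ∸ toℕ y)) % M

Tiling : (M : ℕ) .{{_ : NonZero M}} → (Fin M → Set) → (Fin M → Set) → Set
Tiling M A B =
  ((x : Fin M) → ∃[ a ] ∃[ b ] (A a × B b × SumIs M a b x)) ×
  ((a a' b b' x : Fin M) → A a → A a' → B b → B b' →
     SumIs M a b x → SumIs M a' b' x → (a ≡ a') × (b ≡ b'))

Match : ℕ → ℕ → ℕ → Set
Match q u v = gcd u q ≡ gcd v q

ExactDiv : (M p β x : ℕ) → Set
ExactDiv M p β x = (p ^ β ∣ gcd x M) × ¬ (p ^ suc β ∣ gcd x M)

-- Hence any m ∣ M dividing z − z' divides the sum of the two differences, so it
-- has the same gcd with each of them; taking m = p_i^{n_i} gives (ii). For (iii),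
-- (i) with m = p_j^β gives (a − a', p_j^β) = (b − b', p_j^β), and β < n_j since
-- otherwise the differences would match. If p_j^β did not divide a − a', it would
-- divide neither difference, and then both gcds with p_j^{n_j} collapse to the
-- gcds with p_j^β, which agree: the differences would match after all.
module Submission where

open import Data.Empty using (⊥-elim)
open import Data.Fin using (Fin; toℕ)
import Data.Fin as Fin
open import Data.Fin.Properties using (toℕ≤n)
open import Data.Nat using (ℕ; zero; suc; _+_; _*_; _∸_; _^_; _≤_; NonZero)
open import Data.Nat.Coprimality using (Coprime; coprime-divisor)
open import Data.Nat.Divisibility
open import Data.Nat.DivMod
open import Data.Nat.GCD using (gcd; gcd[m,n]∣m; gcd[m,n]∣n; gcd-greatest)
open import Data.Nat.Primality using (Prime; prime⇒irreducible; prime⇒nonZero)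
open import Data.Nat.Properties
open import Algebra.Properties.CommutativeSemigroup +-commutativeSemigroup
  using (interchange; xy∙z≈x∙zy; xy∙z≈xz∙y)
open import Data.Product using (_×_; _,_; ∃-syntax)
open import Data.Sum using (inj₁; inj₂)
open import Function.Definitions using (Injective)
open import Relation.Binary.PropositionalEquality
open import Relation.Nullary using (¬_; yes; no)

open import Defs

∣m+n⇒gcd[m,d]≡gcd[n,d] : ∀ {d} m n → d ∣ m + n → gcd m d ≡ gcd n d
∣m+n⇒gcd[m,d]≡gcd[n,d] {d} m n d∣m+n =
  ∣-antisym (gcd-mono m n d∣m+n) (gcd-mono n m (subst (d ∣_) (+-comm m n) d∣m+n))
  where
  gcd-mono : ∀ m n → d ∣ m + n → gcd m d ∣ gcd n d
  gcd-mono m n d∣m+n = gcd-greatest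
    (∣m+n∣m⇒∣n (∣-trans (gcd[m,n]∣n m d) d∣m+n) (gcd[m,n]∣m m d))
    (gcd[m,n]∣n m d)

module _ {M : ℕ} .{{_ : NonZero M}} where

  %-absorbˡ : ∀ m n → (m % M + n) % M ≡ (m + n) % M
  %-absorbˡ m n = begin
    (m % M + n) % M         ≡⟨ %-distribˡ-+ (m % M) n M ⟩
    (m % M % M + n % M) % M ≡⟨ cong (λ k → (k + n % M) % M) (m%n%n≡m%n m M) ⟩
    (m % M + n % M) % M     ≡⟨ %-distribˡ-+ m n M ⟨
    (m + n) % M             ∎
    where open ≡-Reasoning

  +-congˡ-% : ∀ m {n o} → n % M ≡ o % M → (m + n) % M ≡ (m + o) % M
  +-congˡ-% m {n} {o} n≡o = begin
    (m + n) % M           ≡⟨ %-distribˡ-+ m n M ⟩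
    (m % M + n % M) % M   ≡⟨ cong (λ k → (m % M + k) % M) n≡o ⟩
    (m % M + o % M) % M   ≡⟨ %-distribˡ-+ m o M ⟨
    (m + o) % M           ∎
    where open ≡-Reasoning

  -- M ∸ x represents −x in Z_M (for x ≤ M), so this says −x − y = −(x + y).
  [M∸m]+[M∸n]≡M∸[m+n]%M : ∀ {m n} → m ≤ M → n ≤ M →
    ((M ∸ m) + (M ∸ n)) % M ≡ (M ∸ (m + n) % M) % M
  [M∸m]+[M∸n]≡M∸[m+n]%M {m} {n} m≤M n≤M = begin
    (m̄ + n̄) % M         ≡⟨ [m+kn]%n≡m%n (m̄ + n̄) q M ⟨
    (m̄ + n̄ + q * M) % M ≡⟨ cong (_% M) (+-cancelʳ-≡ r _ _ shifted) ⟩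
    (r̄ + M) % M         ≡⟨ [m+n]%n≡m%n r̄ M ⟩
    r̄ % M               ∎
    where
    open ≡-Reasoning
    m̄ = M ∸ m
    n̄ = M ∸ n
    q = (m + n) / M
    r = (m + n) % M
    r̄ = M ∸ r
    shifted : m̄ + n̄ + q * M + r ≡ r̄ + M + r
    shifted = begin
      m̄ + n̄ + q * M + r   ≡⟨ xy∙z≈x∙zy (m̄ + n̄) (q * M) r ⟩
      m̄ + n̄ + (r + q * M) ≡⟨ cong (m̄ + n̄ +_) (m≡m%n+[m/n]*n (m + n) M) ⟨
      m̄ + n̄ + (m + n)     ≡⟨ interchange m̄ n̄ m n ⟩
      (m̄ + m) + (n̄ + n)   ≡⟨ cong₂ _+_ (m∸n+n≡m m≤M) (m∸n+n≡m n≤M) ⟩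
      M + M               ≡⟨ cong (_+ M) (m∸n+n≡m (m%n≤n (m + n) M)) ⟨
      r̄ + r + M           ≡⟨ xy∙z≈xz∙y r̄ r M ⟩
      r̄ + M + r           ∎

  dif-+-dif : ∀ z z' a a' b b' → SumIs M a b z → SumIs M a' b' z' →
    (dif M a a' + dif M b b') % M ≡ dif M z z'
  dif-+-dif z z' a a' b b' a+b≡z a'+b'≡z' = begin
    ((A + Ā') % M + (B + B̄') % M) % M ≡⟨ %-distribˡ-+ (A + Ā') (B + B̄') M ⟨
    ((A + Ā') + (B + B̄')) % M         ≡⟨ cong (_% M) (interchange A Ā' B B̄') ⟩
    ((A + B) + (Ā' + B̄')) % M         ≡⟨ %-absorbˡ (A + B) (Ā' + B̄') ⟨
    ((A + B) % M + (Ā' + B̄')) % M     ≡⟨ cong (λ k → (k + (Ā' + B̄')) % M) a+b≡z ⟩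
    (toℕ z + (Ā' + B̄')) % M           ≡⟨ +-congˡ-% (toℕ z) complement ⟩
    (toℕ z + (M ∸ toℕ z')) % M        ∎
    where
    open ≡-Reasoning
    A = toℕ a
    B = toℕ b
    Ā' = M ∸ toℕ a'
    B̄' = M ∸ toℕ b'
    complement : (Ā' + B̄') % M ≡ (M ∸ toℕ z') % M
    complement = trans ([M∸m]+[M∸n]≡M∸[m+n]%M (toℕ≤n a') (toℕ≤n b'))
                       (cong (λ k → (M ∸ k) % M) a'+b'≡z')

  gcd-dif≡gcd-dif : ∀ z z' a a' b b' {m} → SumIs M a b z → SumIs M a' b' z' →
    m ∣ M → m ∣ dif M z z' → gcd (dif M a a') m ≡ gcd (dif M b b') m
  gcd-dif≡gcd-dif z z' a a' b b' a+b≡z a'+b'≡z' m∣M m∣dz =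
    ∣m+n⇒gcd[m,d]≡gcd[n,d] (dif M a a') (dif M b b')
      (∣n∣m%n⇒∣m m∣M (subst (_ ∣_) (sym (dif-+-dif z z' a a' b b' a+b≡z a'+b'≡z')) m∣dz))

^-monoʳ-∣ : ∀ p {m n} → m ≤ n → p ^ m ∣ p ^ n
^-monoʳ-∣ p {m} {n} m≤n = divides (p ^ (n ∸ m)) (begin
  p ^ n               ≡⟨ cong (p ^_) (m∸n+n≡m m≤n) ⟨
  p ^ (n ∸ m + m)     ≡⟨ ^-distribˡ-+-* p (n ∸ m) m ⟩
  p ^ (n ∸ m) * p ^ m ∎)
  where open ≡-Reasoning

∤⇒coprime : ∀ {p d} → Prime p → ¬ (p ∣ d) → Coprime d p
∤⇒coprime pr p∤d (e∣d , e∣p) with prime⇒irreducible pr e∣p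
... | inj₁ e≡1 = e≡1
... | inj₂ refl = ⊥-elim (p∤d e∣d)

∣p^n⇒≡p^k : ∀ {p d} n → Prime p → d ∣ p ^ n → ∃[ k ] d ≡ p ^ k
∣p^n⇒≡p^k zero _ d∣1 = 0 , ∣1⇒≡1 d∣1
∣p^n⇒≡p^k {p} {d} (suc n) pr d∣p^1+n with p ∣? d
... | no p∤d = ∣p^n⇒≡p^k n pr (coprime-divisor (∤⇒coprime pr p∤d) d∣p^1+n)
... | yes (divides q refl) with ∣p^n⇒≡p^k n pr q∣p^n
  where
  instance _ = prime⇒nonZero pr
  q∣p^n : q ∣ p ^ n
  q∣p^n = *-cancelʳ-∣ p (subst (q * p ∣_) (*-comm p (p ^ n)) d∣p^1+n)
...   | k , refl = suc k , *-comm (p ^ k) p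

∣p^n∧∤p^β⇒∣p^β : ∀ {p d} n β → Prime p → d ∣ p ^ n → ¬ (p ^ β ∣ d) → d ∣ p ^ β
∣p^n∧∤p^β⇒∣p^β {p} n β pr d∣p^n p^β∤d with ∣p^n⇒≡p^k n pr d∣p^n
... | k , refl with ≤-total k β
...   | inj₁ k≤β = ^-monoʳ-∣ p k≤β
...   | inj₂ β≤k = ⊥-elim (p^β∤d (^-monoʳ-∣ p β≤k))

gcd[w,p^n]≡gcd[w,p^β] : ∀ {p} w {β n} → Prime p → β ≤ n → ¬ (p ^ β ∣ w) →
  gcd w (p ^ n) ≡ gcd w (p ^ β)
gcd[w,p^n]≡gcd[w,p^β] {p} w {β} {n} pr β≤n p^β∤w = ∣-antisym
  (gcd-greatest (gcd[m,n]∣m w (p ^ n))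
    (∣p^n∧∤p^β⇒∣p^β n β pr (gcd[m,n]∣n w (p ^ n))
      (λ p^β∣g → p^β∤w (∣-trans p^β∣g (gcd[m,n]∣m w (p ^ n))))))
  (gcd-greatest (gcd[m,n]∣m w (p ^ β))
    (∣-trans (gcd[m,n]∣n w (p ^ β)) (^-monoʳ-∣ p β≤n)))

mismatch⇒p^β∣ : ∀ {p} u v {β n} → Prime p → β ≤ n →
  gcd u (p ^ β) ≡ gcd v (p ^ β) → ¬ (gcd u (p ^ n) ≡ gcd v (p ^ n)) → p ^ β ∣ u
mismatch⇒p^β∣ {p} u v {β} {n} pr β≤n match-β mismatch-n with p ^ β ∣? u
... | yes p^β∣u = p^β∣u
... | no p^β∤u = ⊥-elim (mismatch-n (begin
  gcd u (p ^ n) ≡⟨ gcd[w,p^n]≡gcd[w,p^β] u pr β≤n p^β∤u ⟩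
  gcd u (p ^ β) ≡⟨ match-β ⟩
  gcd v (p ^ β) ≡⟨ gcd[w,p^n]≡gcd[w,p^β] v pr β≤n p^β∤v ⟨
  gcd v (p ^ n) ∎))
  where
  open ≡-Reasoning
  p^β∤v : ¬ (p ^ β ∣ v)
  p^β∤v p^β∣v = p^β∤u (subst (_∣ u)
    (trans match-β (∣-antisym (gcd[m,n]∣n v (p ^ β)) (gcd-greatest p^β∣v ∣-refl)))
    (gcd[m,n]∣m u (p ^ β)))

∣∏ : ∀ K (f : Fin K → ℕ) i → f i ∣ ∏ K f
∣∏ (suc K) f Fin.zero = m∣m*n (∏ K (λ i → f (Fin.suc i)))
∣∏ (suc K) f (Fin.suc i) = ∣n⇒∣m*n (f Fin.zero) (∣∏ K (λ j → f (Fin.suc j)) i)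

lemma4p3 : (M : ℕ) .{{_ : NonZero M}} (K : ℕ) (p n : Fin K → ℕ) →
  (∀ i → Prime (p i)) → Injective _≡_ _≡_ p → (∀ i → 1 ≤ n i) →
  M ≡ ∏ K (λ i → p i ^ n i) →
  (A B : Fin M → Set) → Tiling M A B →
  (z z' a a' b b' : Fin M) → A a → A a' → B b → B b' →
  SumIs M a b z → SumIs M a' b' z' →
  ((m : ℕ) → m ∣ M → m ∣ dif M z z' → gcd (dif M a a') m ≡ gcd (dif M b b') m)
  × ((i : Fin K) → p i ^ n i ∣ dif M z z' →
       Match (p i ^ n i) (dif M a a') (dif M b b'))
  × ((j : Fin K) (β : ℕ) → ¬ Match (p j ^ n j) (dif M a a') (dif M b b') →
       ExactDiv M (p j) β (dif M z z') →
       (p j ^ β ∣ dif M a a') × (p j ^ β ∣ dif M b b'))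
lemma4p3 M K p n prime _ _ M≡∏ _ _ _ z z' a a' b b' _ _ _ _ a+b≡z a'+b'≡z' =
  matchᵢ , matchᵢᵢ , matchᵢᵢᵢ
  where
  u = dif M a a'
  v = dif M b b'
  dz = dif M z z'
  matchᵢ : (m : ℕ) → m ∣ M → m ∣ dz → gcd u m ≡ gcd v m
  matchᵢ m = gcd-dif≡gcd-dif z z' a a' b b' a+b≡z a'+b'≡z'
  p^n∣M : ∀ i → p i ^ n i ∣ M
  p^n∣M i = subst (_ ∣_) (sym M≡∏) (∣∏ K (λ i → p i ^ n i) i)
  matchᵢᵢ : (i : Fin K) → p i ^ n i ∣ dz → Match (p i ^ n i) u v
  matchᵢᵢ i = matchᵢ (p i ^ n i) (p^n∣M i)
  matchᵢᵢᵢ : (j : Fin K) (β : ℕ) → ¬ Match (p j ^ n j) u v → ExactDiv M (p j) β dz →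
    (p j ^ β ∣ u) × (p j ^ β ∣ v)
  matchᵢᵢᵢ j β mismatch (p^β∣gcd , _) =
    mismatch⇒p^β∣ u v (prime j) β≤n match-β mismatch ,
    mismatch⇒p^β∣ v u (prime j) β≤n (sym match-β) (λ eq → mismatch (sym eq))
    where
    p^β∣dz = ∣-trans p^β∣gcd (gcd[m,n]∣m dz M)
    match-β = matchᵢ (p j ^ β) (∣-trans p^β∣gcd (gcd[m,n]∣n dz M)) p^β∣dz
    β≤n : β ≤ n j
    β≤n = <⇒≤ (≰⇒> (λ n≤β → mismatch (matchᵢᵢ j (∣-trans (^-monoʳ-∣ (p j) n≤β) p^β∣dz))))
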